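{- Let $q \ge 3$ be a fixed integer and let $x,y \in [n]$ be distinct integers. Then the number of pairs $(a,b)$ of distinct elements of $[n]$ such that there is an arithmetic progression of length $q$ containing $\{x,a,b\}$ and an arithmetic progression of length $q$ containing $\{y,a,b\}$ is $O(1)$, where the implied constant depends only on $q$.
   Context: $[n]=\{1,\dotsc,n\}$; arithmetic progressions have nonzero common difference. -}

module Defs where

open import Data.Nat using (ℕ; _<_)
open import Data.Integer using (ℤ; +_; _+_; _*_; _≤_; 0ℤ; 1ℤ)
open import Data.Product using (_×_; _,_; ∃-syntax)
open import Relation.Binary.PropositionalEquality using (_≡_; _≢_)

InRange : ℕ → ℤ → Set
InRange n z = (1ℤ ≤ z) × (z ≤ + n)

IsAPIn : ℕ → ℕ → ℤ → ℤ → Set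
IsAPIn q n c d = (d ≢ 0ℤ) × (∀ (i : ℕ) → i < q → InRange n (c + (+ i) * d))

InAP : ℕ → ℤ → ℤ → ℤ → Set
InAP q c d z = ∃[ i ] (i < q × z ≡ c + (+ i) * d)

APContains3 : ℕ → ℕ → ℤ → ℤ → ℤ → Set
APContains3 q n u v w =
  ∃[ c ] ∃[ d ] (IsAPIn q n c d × InAP q c d u × InAP q c d v × InAP q c d w)

GoodPair : ℕ → ℕ → ℤ → ℤ → ℤ × ℤ → Set
GoodPair q n x y (a , b) =
  InRange n a × InRange n b × (a ≢ b) × APContains3 q n x a b × APContains3 q n y a b

{-# OPTIONS --safe #-}

-- A good pair (a , b) is pinned down by the positions of x, a, b in the first
-- progression and of y, a, b in the second, q⁶ possibilities in all.  With
-- a = x + s d = y + s′ e and b = x + t d = y + t′ e for the offsets s, t, s′, t′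
-- read off from these positions, eliminating d gives
-- (t s′ − s t′) e = (t − s)(x − y), which is nonzero because a ≢ b and x ≢ y.
-- So the offsets determine e, and hence a and b.  No assumption on q is needed.
module Submission where

open import Defs
open import Data.Nat using (ℕ; _≤_; _<_)
import Data.Nat as ℕ
open import Data.Integer using (ℤ; +_; _+_; _*_; _-_; 0ℤ; ≢-nonZero)
import Data.Integer.Properties as ℤ
open import Data.Integer.Tactic.RingSolver using (solve; solve-∀)
open import Data.Fin using (Fin; zero; suc; toℕ; fromℕ<; combine)
open import Data.Fin.Properties using (toℕ-fromℕ<; combine-injective; injective⇒≤)
open import Data.List using (List; []; _∷_; length; lookup)
open import Data.List.Membership.Propositional.Properties using (∈-lookup)
open import Data.List.Relation.Unary.All as All using (All)
open import Data.List.Relation.Unary.AllPairs using (_∷_)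
open import Data.List.Relation.Unary.Unique.Propositional using (Unique)
open import Data.Product using (_×_; _,_; proj₁; proj₂; ∃-syntax)
open import Data.Sum using (inj₁; inj₂)
open import Relation.Binary.PropositionalEquality
open import Relation.Nullary using (contradiction)

private
  variable
    A : Set
    m q n : ℕ
    u v w x y : ℤ

lookup-injective : {xs : List A} → Unique xs → {i j : Fin (length xs)} →
  lookup xs i ≡ lookup xs j → i ≡ j
lookup-injective (_ ∷ _)         {zero}  {zero}  _  = refl
lookup-injective (x∉xs ∷ _)      {zero}  {suc j} eq = contradiction eq (All.lookup x∉xs (∈-lookup j))
lookup-injective (x∉xs ∷ _)      {suc i} {zero}  eq = contradiction (sym eq) (All.lookup x∉xs (∈-lookup i))
lookup-injective (_ ∷ unique-xs) {suc i} {suc j} eq = cong suc (lookup-injective unique-xs eq)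

unique⇒length≤ : {P : A → Set} {xs : List A} (label : ∀ {x} → P x → Fin m) →
  (∀ {x y} (px : P x) (py : P y) → label px ≡ label py → x ≡ y) →
  Unique xs → All P xs → length xs ≤ m
unique⇒length≤ {m = m} {xs = xs} label label-injective unique-xs pxs =
  injective⇒≤ {f = labelAt} λ eq → lookup-injective unique-xs (label-injective _ _ eq)
  where
  labelAt : Fin (length xs) → Fin m
  labelAt i = label (All.lookup pxs (∈-lookup i))

record AtOffsets (u : ℤ) (σ p : ℤ × ℤ) : Set where
  constructor stepping
  field
    step   : ℤ
    first  : proj₁ p ≡ u + proj₁ σ * step
    second : proj₂ p ≡ u + proj₂ σ * step

determinant : ℤ × ℤ → ℤ × ℤ → ℤ
determinant (s , t) (s′ , t′) = t * s′ - s * t′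

module TwoProgressions (x y s t s′ t′ : ℤ) where

  cramer : ∀ {d e} → x + s * d ≡ y + s′ * e → x + t * d ≡ y + t′ * e →
    determinant (s , t) (s′ , t′) * e ≡ (t - s) * (x - y)
  cramer {d} {e} a≡ b≡ = begin
    (t * s′ - s * t′) * e                             ≡⟨ solve (t ∷ s ∷ s′ ∷ t′ ∷ e ∷ y ∷ []) ⟩
    t * (y + s′ * e) - s * (y + t′ * e) - (t - s) * y ≡⟨ cong₂ (λ a b → t * a - s * b - (t - s) * y) a≡ b≡ ⟨
    t * (x + s * d) - s * (x + t * d) - (t - s) * y   ≡⟨ solve (t ∷ s ∷ x ∷ d ∷ y ∷ []) ⟩
    (t - s) * (x - y)                                 ∎
    where open ≡-Reasoning

  determinant≢0 : ∀ {d e} → x ≢ y → x + s * d ≢ x + t * d →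
    x + s * d ≡ y + s′ * e → x + t * d ≡ y + t′ * e → determinant (s , t) (s′ , t′) ≢ 0ℤ
  determinant≢0 {d} {e} x≢y a≢b a≡ b≡ det≡0
    with ℤ.i*j≡0⇒i≡0∨j≡0 (t - s) (begin
      (t - s) * (x - y)                 ≡⟨ cramer a≡ b≡ ⟨
      determinant (s , t) (s′ , t′) * e ≡⟨ cong (_* e) det≡0 ⟩
      0ℤ * e                            ≡⟨ ℤ.*-zeroˡ e ⟩
      0ℤ                                ∎)
    where open ≡-Reasoning
  ... | inj₁ t-s≡0 = a≢b (cong (λ r → x + r * d) (sym (ℤ.i-j≡0⇒i≡j t s t-s≡0)))
  ... | inj₂ x-y≡0 = x≢y (ℤ.i-j≡0⇒i≡j x y x-y≡0)

offsets-determine-pair : ∀ {x y σ τ a b a₁ b₁} → x ≢ y → a ≢ b →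
  AtOffsets x σ (a , b) → AtOffsets y τ (a , b) →
  AtOffsets x σ (a₁ , b₁) → AtOffsets y τ (a₁ , b₁) → (a , b) ≡ (a₁ , b₁)
offsets-determine-pair {x} {y} {s , t} {s′ , t′} x≢y a≢b
  (stepping d refl refl) (stepping e a≡ b≡) (stepping _ refl refl) (stepping e₁ a₁≡ b₁≡) =
  cong₂ _,_ (along s′ a≡ a₁≡) (along t′ b≡ b₁≡)
  where
  open TwoProgressions x y s t s′ t′

  e≡e₁ : e ≡ e₁
  e≡e₁ = ℤ.*-cancelˡ-≡ (determinant (s , t) (s′ , t′)) e e₁ {{≢-nonZero (determinant≢0 x≢y a≢b a≡ b≡)}}
    (trans (cramer a≡ b≡) (sym (cramer a₁≡ b₁≡)))

  along : ∀ r {u u₁} → u ≡ y + r * e → u₁ ≡ y + r * e₁ → u ≡ u₁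
  along r u≡ u₁≡ = trans u≡ (trans (cong (λ z → y + r * z) e≡e₁) (sym u₁≡))

index : {P : ℕ → Set} → ∃[ i ] (i < q × P i) → Fin q
index (_ , i<q , _) = fromℕ< i<q

Positions : ℕ → Set
Positions q = Fin q × Fin q × Fin q

positions : APContains3 q n u v w → Positions q
positions (_ , _ , _ , hu , hv , hw) = index hu , index hv , index hw

offsets : Positions q → ℤ × ℤ
offsets (i , j , k) = + toℕ j - + toℕ i , + toℕ k - + toℕ i

shift-origin : ∀ c d I J → c + J * d ≡ (c + I * d) + (J - I) * d
shift-origin = solve-∀

atOffsets : (h : APContains3 q n u v w) → AtOffsets u (offsets (positions h)) (v , w)
atOffsets (c , d , _ , (i , i<q , refl) , (j , j<q , refl) , (k , k<q , refl))
  rewrite toℕ-fromℕ< i<q | toℕ-fromℕ< j<q | toℕ-fromℕ< k<q =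
  stepping d (shift-origin c d (+ i) (+ j)) (shift-origin c d (+ i) (+ k))

cube : ℕ → ℕ
cube q = q ℕ.* (q ℕ.* q)

encode : Positions q → Fin (cube q)
encode (i , j , k) = combine i (combine j k)

encode-injective : (π π′ : Positions q) → encode π ≡ encode π′ → π ≡ π′
encode-injective (i , j , k) (i′ , j′ , k′) eq with combine-injective i _ i′ _ eq
... | refl , eq′ with combine-injective j k j′ k′ eq′
... | refl , refl = refl

label : ∀ {p} → GoodPair q n x y p → Fin (cube q ℕ.* cube q)
label (_ , _ , _ , hx , hy) = combine (encode (positions hx)) (encode (positions hy))

label-injective : ∀ {p p′} → x ≢ y → (h : GoodPair q n x y p) (h′ : GoodPair q n x y p′) →
  label h ≡ label h′ → p ≡ p′
label-injective x≢y (_ , _ , a≢b , hx , hy) (_ , _ , _ , hx′ , hy′) eq =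
  offsets-determine-pair x≢y a≢b (atOffsets hx) (atOffsets hy)
    (subst (λ π → AtOffsets _ (offsets π) _) positions-x≡ (atOffsets hx′))
    (subst (λ π → AtOffsets _ (offsets π) _) positions-y≡ (atOffsets hy′))
  where
  codes≡ : encode (positions hx) ≡ encode (positions hx′) × encode (positions hy) ≡ encode (positions hy′)
  codes≡ = combine-injective (encode (positions hx)) (encode (positions hy))
                             (encode (positions hx′)) (encode (positions hy′)) eq

  positions-x≡ : positions hx′ ≡ positions hx
  positions-x≡ = encode-injective _ _ (sym (proj₁ codes≡))

  positions-y≡ : positions hy′ ≡ positions hy
  positions-y≡ = encode-injective _ _ (sym (proj₂ codes≡))

lemma6p13 : (q : ℕ) → 3 ≤ q →
    ∃[ C ] ((n : ℕ) (x y : ℤ) → InRange n x → InRange n y → x ≢ y →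
      (ps : List (ℤ × ℤ)) → Unique ps → All (GoodPair q n x y) ps →
      length ps ≤ C)
lemma6p13 q _ = cube q ℕ.* cube q , λ n x y _ _ x≢y ps →
  unique⇒length≤ label (label-injective x≢y)
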